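{- Let $A$, $X$ and $B\neq\mathbf{0}$ be permutations with $A$ pseudo-cancelable. If $AX=B$, then $C_{d\cdot\mathrm{alcm}_A B}$ is a submultiset of $X$ (i.e. $X$ contains a cycle of length $d\cdot\mathrm{alcm}_A B$) for some divisor $d$ of $\ell(A)$ coprime with $\mathrm{alcm}_A B$.
   Context: A permutation is a finite set with a bijection on it up to isomorphism, i.e. a multiset of cycles; $C_n$ is the cycle of length $n$ and $\mathbf{0}$ the empty permutation. Sum is disjoint union, product is the direct product of digraphs, so $C_aC_b=\gcd(a,b)\,C_{\lcm(a,b)}$. For nonzero $A$, $\ell(A)$ is the smallest cycle length in $A$; $A$ is pseudo-cancelable if every cycle length of $A$ is a multiple of $\ell(A)$. For integers $a\mid b$, $\mathrm{alcm}_a b$ is the smallest positive $c$ with $\lcm(a,c)=b$, and $\mathrm{alcm}_A B=\mathrm{alcm}_{\ell(A)}\ell(B)$. -}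

module Defs where

open import Data.Nat using (ℕ; zero; suc; _*_; _<_; _≤_; _⊓_)
open import Data.Nat.GCD using (gcd)
open import Data.Nat.LCM using (lcm)
open import Data.Nat.Divisibility using (_∣_)
open import Data.List using (List; []; _∷_; foldr; replicate; concatMap)
open import Data.List.Relation.Unary.All using (All)
open import Data.List.Relation.Binary.Permutation.Propositional using (_↭_)
open import Data.Product using (_×_)
open import Relation.Binary.PropositionalEquality using (_≡_; _≢_)

-- A permutation (up to isomorphism) is a finite multiset of cycles, represented
-- by the list of its cycle lengths (each positive), taken up to reordering (_↭_).
-- The cycle C_n is the one-element list [ n ]; the empty permutation 0 is [].
Perm : Set
Perm = List ℕ

WF : Perm → Set
WF A = All (λ n → 0 < n) A

-- product of two single cycles: C_a C_b = gcd(a,b) C_lcm(a,b)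
cycProd : ℕ → ℕ → Perm
cycProd a b = replicate (gcd a b) (lcm a b)

_⊗_ : Perm → Perm → Perm
A ⊗ X = concatMap (λ a → concatMap (λ x → cycProd a x) X) A

_≅_ : Perm → Perm → Set
A ≅ B = A ↭ B

-- ℓ(A): smallest cycle length (only meaningful for nonzero A; ℓ [] = 0 is a dummy)
ℓ : Perm → ℕ
ℓ []      = 0
ℓ (a ∷ A) = foldr _⊓_ a A

PseudoCancelable : Perm → Set
PseudoCancelable A = (A ≢ []) × All (λ n → ℓ A ∣ n) A

IsAlcm : ℕ → ℕ → ℕ → Set
IsAlcm a b c = (0 < c) × (lcm a c ≡ b) × (∀ c′ → 0 < c′ → lcm a c′ ≡ b → c ≤ c′)

{-# OPTIONS --safe #-}
module Submission where

-- Write a = ℓ A and b = ℓ B. The shortest cycle of A X has length lcm a′ x for some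
-- cycles a′ of A and x of X; since a ∣ a′, lcm a x divides b and is itself a cycle
-- length of A X, so lcm a x = b. Minimality of c = alcm_a b is used in one form: a
-- divisor y of c with c ∣ lcm a y equals c. Taking y = gcd c x (lcm distributes over
-- gcd) gives x = d c; taking y = c / e for a common divisor e of d and c gives e = 1;
-- and d ∣ a since d c ∣ lcm a c exactly when d gcd(a, c) ∣ a.

open import Defs
open import Data.Nat using (ℕ; suc; _*_; _≤_; _<_; _⊓_; NonZero; >-nonZero; ≢-nonZero; ≢-nonZero⁻¹)
open import Data.Nat.Properties
  using (n≢0⇒n>0; ≤-reflexive; ≤-antisym; m≤n⇒m⊓o≤n; m≤n⇒o⊓m≤n; ⊓-sel;
         *-comm; *-assoc; *-identityʳ; *-cancelˡ-≡)
open import Data.Nat.Divisibility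
  using (_∣_; divides; 0∣⇒≡0; ∣-trans; ∣-antisym; ∣⇒≤; ∣m⇒∣m*n; m*n∣⇒m∣;
         *-pres-∣; *-monoˡ-∣; *-monoʳ-∣; *-cancelˡ-∣; *-cancelʳ-∣)
open import Data.Nat.DivMod using (_/_; m*[n/m]≡n)
open import Data.Nat.GCD
  using (gcd; gcd[m,n]∣m; gcd[m,n]∣n; gcd[m,n]≢0; gcd-greatest; c*gcd[m,n]≡gcd[cm,cn])
open import Data.Nat.LCM using (lcm; m∣lcm[m,n]; n∣lcm[m,n]; lcm-least; gcd*lcm)
open import Data.Nat.Coprimality using (Coprime; coprime⇒gcd≡1; coprime-/gcd)
open import Data.List using ([]; _∷_; replicate)
open import Data.List.Properties using (foldr-preservesᵒ)
open import Data.List.Relation.Unary.Any as Any using (Any; here; there)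
open import Data.List.Relation.Unary.All using (lookup)
open import Data.List.Relation.Unary.All.Properties using (replicate⁺)
open import Data.List.Membership.Propositional using (_∈_; find; lose)
open import Data.List.Membership.Propositional.Properties
  using (∈-concatMap⁺; ∈-concatMap⁻; foldr-selective)
open import Data.List.Relation.Binary.Permutation.Propositional using (↭-sym)
open import Data.List.Relation.Binary.Permutation.Propositional.Properties using (∈-resp-↭)
open import Data.Product using (_×_; _,_; proj₁; proj₂; ∃-syntax)
open import Data.Sum using (_⊎_; inj₁; inj₂)
open import Relation.Nullary using (contradiction)
open import Relation.Binary.PropositionalEquality
  using (_≡_; _≢_; refl; sym; trans; cong; subst; subst₂; module ≡-Reasoning)

gcd≢0ˡ : ∀ m n .{{_ : NonZero m}} → NonZero (gcd m n)
gcd≢0ˡ m n = ≢-nonZero (gcd[m,n]≢0 m n (inj₁ (≢-nonZero⁻¹ m)))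

-- With g = gcd m o, m = g k and o = g j where k, j are coprime; m divides both
-- lcm n g * k and lcm n g * j, hence their gcd, which is lcm n g.
m∣lcm[n,o]⇒m∣lcm[n,gcd[m,o]] : ∀ {m} n o .{{_ : NonZero m}} →
                                m ∣ lcm n o → m ∣ lcm n (gcd m o)
m∣lcm[n,o]⇒m∣lcm[n,gcd[m,o]] {m} n o m∣lcm[n,o] = subst (m ∣_) gcd[L*k,L*j]≡L m∣gcd[L*k,L*j]
  where
  instance _ = gcd≢0ˡ m o
  g k j L : ℕ
  g = gcd m o
  k = m / g
  j = o / g
  L = lcm n g
  g∣L : g ∣ L
  g∣L = n∣lcm[m,n] n g
  m∣L*k : m ∣ L * k
  m∣L*k = subst (_∣ L * k) (m*[n/m]≡n (gcd[m,n]∣m m o)) (*-monoˡ-∣ k g∣L)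
  o∣L*j : o ∣ L * j
  o∣L*j = subst (_∣ L * j) (m*[n/m]≡n (gcd[m,n]∣n m o)) (*-monoˡ-∣ j g∣L)
  m∣L*j : m ∣ L * j
  m∣L*j = ∣-trans m∣lcm[n,o] (lcm-least (∣m⇒∣m*n j (m∣lcm[m,n] n g)) o∣L*j)
  m∣gcd[L*k,L*j] : m ∣ gcd (L * k) (L * j)
  m∣gcd[L*k,L*j] = gcd-greatest m∣L*k m∣L*j
  gcd[L*k,L*j]≡L : gcd (L * k) (L * j) ≡ L
  gcd[L*k,L*j]≡L = begin
    gcd (L * k) (L * j) ≡⟨ sym (c*gcd[m,n]≡gcd[cm,cn] L k j) ⟩
    L * gcd k j         ≡⟨ cong (L *_) (coprime⇒gcd≡1 (coprime-/gcd m o)) ⟩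
    L * 1               ≡⟨ *-identityʳ L ⟩
    L                   ∎
    where open ≡-Reasoning

private
  gcd*[k*n]≡[k*gcd]*n : ∀ k m n → gcd m n * (k * n) ≡ k * gcd m n * n
  gcd*[k*n]≡[k*gcd]*n k m n = begin
    gcd m n * (k * n) ≡⟨ *-assoc (gcd m n) k n ⟨
    gcd m n * k * n   ≡⟨ cong (_* n) (*-comm (gcd m n) k) ⟩
    k * gcd m n * n   ∎
    where open ≡-Reasoning

k*n∣lcm[m,n]⇒k*gcd[m,n]∣m : ∀ k m n .{{_ : NonZero n}} → k * n ∣ lcm m n → k * gcd m n ∣ m
k*n∣lcm[m,n]⇒k*gcd[m,n]∣m k m n k*n∣lcm = *-cancelʳ-∣ n
  (subst₂ _∣_ (gcd*[k*n]≡[k*gcd]*n k m n) (gcd*lcm m n) (*-monoʳ-∣ (gcd m n) k*n∣lcm))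

k*gcd[m,n]∣m⇒k*n∣lcm[m,n] : ∀ k m n .{{_ : NonZero m}} → k * gcd m n ∣ m → k * n ∣ lcm m n
k*gcd[m,n]∣m⇒k*n∣lcm[m,n] k m n k*gcd∣m = *-cancelˡ-∣ (gcd m n) {{gcd≢0ˡ m n}}
  (subst₂ _∣_ (sym (gcd*[k*n]≡[k*gcd]*n k m n)) (sym (gcd*lcm m n)) (*-monoˡ-∣ n k*gcd∣m))

module _ {a b c : ℕ} .{{_ : NonZero a}} (c-alcm : IsAlcm a b c) where

  private
    lcm[a,c]≡b : lcm a c ≡ b
    lcm[a,c]≡b = proj₁ (proj₂ c-alcm)

    instance
      c≢0 : NonZero c
      c≢0 = >-nonZero (proj₁ c-alcm)

  y∣c⇒c∣lcm[a,y]⇒y≡c : ∀ {y} → y ∣ c → c ∣ lcm a y → y ≡ c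
  y∣c⇒c∣lcm[a,y]⇒y≡c {y} y∣c c∣lcm[a,y] =
    ≤-antisym (∣⇒≤ y∣c) (proj₂ (proj₂ c-alcm) y y>0 lcm[a,y]≡b)
    where
    y>0 : 0 < y
    y>0 = n≢0⇒n>0 (λ y≡0 → ≢-nonZero⁻¹ c (0∣⇒≡0 (subst (_∣ c) y≡0 y∣c)))
    lcm[a,y]≡b : lcm a y ≡ b
    lcm[a,y]≡b = subst (lcm a y ≡_) lcm[a,c]≡b (∣-antisym
      (lcm-least (m∣lcm[m,n] a c) (∣-trans y∣c (n∣lcm[m,n] a c)))
      (lcm-least (m∣lcm[m,n] a y) c∣lcm[a,y]))

  lcm[a,x]≡b⇒c∣x : ∀ {x} → lcm a x ≡ b → c ∣ x
  lcm[a,x]≡b⇒c∣x {x} lcm[a,x]≡b = subst (_∣ x) gcd[c,x]≡c (gcd[m,n]∣n c x)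
    where
    c∣lcm[a,x] : c ∣ lcm a x
    c∣lcm[a,x] = subst (c ∣_) (trans lcm[a,c]≡b (sym lcm[a,x]≡b)) (n∣lcm[m,n] a c)
    gcd[c,x]≡c : gcd c x ≡ c
    gcd[c,x]≡c = y∣c⇒c∣lcm[a,y]⇒y≡c (gcd[m,n]∣m c x)
                                    (m∣lcm[n,o]⇒m∣lcm[n,gcd[m,o]] a x c∣lcm[a,x])

  d*gcd[a,c]∣a⇒coprime[d,c] : ∀ {d} → d * gcd a c ∣ a → Coprime d c
  d*gcd[a,c]∣a⇒coprime[d,c] {d} d*gcd[a,c]∣a {e} (e∣d , divides q c≡q*e) =
    *-cancelˡ-≡ e 1 c c*e≡c*1
    where
    q∣c : q ∣ c
    q∣c = divides e (trans c≡q*e (*-comm q e))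
    gcd[a,q]∣gcd[a,c] : gcd a q ∣ gcd a c
    gcd[a,q]∣gcd[a,c] = gcd-greatest (gcd[m,n]∣m a q) (∣-trans (gcd[m,n]∣n a q) q∣c)
    e*gcd[a,q]∣a : e * gcd a q ∣ a
    e*gcd[a,q]∣a = ∣-trans (*-pres-∣ e∣d gcd[a,q]∣gcd[a,c]) d*gcd[a,c]∣a
    c∣lcm[a,q] : c ∣ lcm a q
    c∣lcm[a,q] = subst (_∣ lcm a q) (trans (*-comm e q) (sym c≡q*e))
                       (k*gcd[m,n]∣m⇒k*n∣lcm[m,n] e a q e*gcd[a,q]∣a)
    c*e≡c*1 : c * e ≡ c * 1
    c*e≡c*1 = begin
      c * e ≡⟨ cong (_* e) (sym (y∣c⇒c∣lcm[a,y]⇒y≡c q∣c c∣lcm[a,q])) ⟩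
      q * e ≡⟨ c≡q*e ⟨
      c     ≡⟨ *-identityʳ c ⟨
      c * 1 ∎
      where open ≡-Reasoning

  lcm[a,x]≡b⇒x≡d*c : ∀ {x} → lcm a x ≡ b → ∃[ d ] (d ∣ a × Coprime d c × d * c ≡ x)
  lcm[a,x]≡b⇒x≡d*c {x} lcm[a,x]≡b with lcm[a,x]≡b⇒c∣x lcm[a,x]≡b
  ... | divides d x≡d*c =
    d , m*n∣⇒m∣ d (gcd a c) d*gcd[a,c]∣a , d*gcd[a,c]∣a⇒coprime[d,c] d*gcd[a,c]∣a , sym x≡d*c
    where
    d*c∣lcm[a,c] : d * c ∣ lcm a c
    d*c∣lcm[a,c] = subst₂ _∣_ x≡d*c (trans lcm[a,x]≡b (sym lcm[a,c]≡b)) (n∣lcm[m,n] a x)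
    d*gcd[a,c]∣a : d * gcd a c ∣ a
    d*gcd[a,c]∣a = k*n∣lcm[m,n]⇒k*gcd[m,n]∣m d a c d*c∣lcm[a,c]

ℓ∈ : ∀ {A} → A ≢ [] → ℓ A ∈ A
ℓ∈ {[]}    A≢[] = contradiction refl A≢[]
ℓ∈ {a ∷ A} _ with foldr-selective ⊓-sel a A
... | inj₁ ℓ≡a   = here ℓ≡a
... | inj₂ ℓ∈A   = there ℓ∈A

ℓ≤ : ∀ {A y} → y ∈ A → ℓ A ≤ y
ℓ≤ {a ∷ A} {y} y∈a∷A = foldr-preservesᵒ ⊓-pres-≤y a A (≤y y∈a∷A)
  where
  ⊓-pres-≤y : ∀ m n → m ≤ y ⊎ n ≤ y → m ⊓ n ≤ y
  ⊓-pres-≤y m n (inj₁ m≤y) = m≤n⇒m⊓o≤n n m≤y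
  ⊓-pres-≤y m n (inj₂ n≤y) = m≤n⇒o⊓m≤n m n≤y
  ≤y : y ∈ a ∷ A → a ≤ y ⊎ Any (_≤ y) A
  ≤y (here y≡a)  = inj₁ (≤-reflexive (sym y≡a))
  ≤y (there y∈A) = inj₂ (Any.map (λ y≡x → ≤-reflexive (sym y≡x)) y∈A)

∈-⊗⁻ : ∀ {A X y} → y ∈ A ⊗ X → ∃[ a ] ∃[ x ] (a ∈ A × x ∈ X × y ≡ lcm a x)
∈-⊗⁻ {A} {X} {y} y∈A⊗X with find (∈-concatMap⁻ _ {xs = A} y∈A⊗X)
... | a , a∈A , y∈a⊗X with find (∈-concatMap⁻ _ {xs = X} y∈a⊗X)
...   | x , x∈X , y∈cycProd =
  a , x , a∈A , x∈X , lookup (replicate⁺ {P = _≡ lcm a x} (gcd a x) refl) y∈cycProd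

lcm∈⊗ : ∀ {A X a x} .{{_ : NonZero a}} → a ∈ A → x ∈ X → lcm a x ∈ A ⊗ X
lcm∈⊗ {A} {X} {a} {x} a∈A x∈X =
  ∈-concatMap⁺ _ (lose a∈A (∈-concatMap⁺ _ (lose x∈X (lcm∈replicate (gcd a x) {{gcd≢0ˡ a x}}))))
  where
  lcm∈replicate : ∀ n .{{_ : NonZero n}} → lcm a x ∈ replicate n (lcm a x)
  lcm∈replicate (suc n) = here refl

ℓ>0 : ∀ {A} → WF A → A ≢ [] → 0 < ℓ A
ℓ>0 wfA A≢[] = lookup wfA (ℓ∈ A≢[])

ℓ[B]≡lcm[ℓ[A],x] : ∀ {A X B} → WF A → WF B → B ≢ [] → PseudoCancelable A → (A ⊗ X) ≅ B →
                   ∃[ x ] (x ∈ X × lcm (ℓ A) x ≡ ℓ B)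
ℓ[B]≡lcm[ℓ[A],x] {A} {X} {B} wfA wfB B≢[] (A≢[] , ℓA∣A) A⊗X≅B =
  let a , x , a∈A , x∈X , ℓB≡lcm[a,x] = ∈-⊗⁻ (∈-resp-↭ (↭-sym A⊗X≅B) (ℓ∈ B≢[]))
      lcm[ℓA,x]∣ℓB : lcm (ℓ A) x ∣ ℓ B
      lcm[ℓA,x]∣ℓB = subst (lcm (ℓ A) x ∣_) (sym ℓB≡lcm[a,x])
        (lcm-least (∣-trans (lookup ℓA∣A a∈A) (m∣lcm[m,n] a x)) (n∣lcm[m,n] a x))
      lcm[ℓA,x]∈B : lcm (ℓ A) x ∈ B
      lcm[ℓA,x]∈B = ∈-resp-↭ A⊗X≅B (lcm∈⊗ {{>-nonZero (ℓ>0 wfA A≢[])}} (ℓ∈ A≢[]) x∈X)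
  in  x , x∈X , ≤-antisym (∣⇒≤ {{>-nonZero (ℓ>0 wfB B≢[])}} lcm[ℓA,x]∣ℓB) (ℓ≤ lcm[ℓA,x]∈B)

lemma20 : (A X B : Perm) → WF A → WF X → WF B → B ≢ [] → PseudoCancelable A →
          (A ⊗ X) ≅ B → (c : ℕ) → IsAlcm (ℓ A) (ℓ B) c →
          ∃[ d ] (d ∣ ℓ A × Coprime d c × (d * c) ∈ X)
lemma20 A X B wfA _ wfB B≢[] pcA@(A≢[] , _) A⊗X≅B c c-alcm =
  let x , x∈X , lcm[ℓA,x]≡ℓB = ℓ[B]≡lcm[ℓ[A],x] wfA wfB B≢[] pcA A⊗X≅B
      d , d∣ℓA , coprime[d,c] , d*c≡x =
        lcm[a,x]≡b⇒x≡d*c {{>-nonZero (ℓ>0 wfA A≢[])}} c-alcm lcm[ℓA,x]≡ℓB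
  in  d , d∣ℓA , coprime[d,c] , subst (_∈ X) (sym d*c≡x) x∈X
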